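{- Let $N$ be a full-rank matroid of dimension at least $3$ whose ground set contains no four distinct elements summing to zero. If $M_1$ and $M_2$ are $N$-free matroids, then $M_1\otimes M_2$ is $N$-free.
   Context: A matroid is a pair $M=(E,G)$ where $G$ is the set of nonzero vectors of a finite-dimensional $\mathbb F_2$-vector space $V(G)=G\cup\{0\}$ and $E\subseteq G$; its dimension is $\dim V(G)$; it is full-rank if $E$ spans $V(G)$. Isomorphism: a linear isomorphism of ambient spaces mapping ground sets onto each other. A flat of $G$ is a set $F\subseteq G$ with $F\cup\{0\}$ a subspace; $M|F=(E\cap F,F)$; $M$ is $N$-free if no $M|F$ is isomorphic to $N$. Lift-join: for $M_i=(E_i,G_i)$, $M_1\otimes M_2=(E_1\cup(E_2+V(G_1)),G_1\oplus G_2)$, where $G_1\oplus G_2$ is the set of nonzero vectors of $V(G_1)\oplus V(G_2)$ with each $V(G_i)$ identified with its copy and $X+Y=\{x+y:x\in X,y\in Y\}$. -}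

module Defs where

open import Data.Nat using (ℕ; _+_; _≥_)
import Data.Nat as ℕ
open import Data.Bool using (Bool; true; false; _xor_; _∧_; _∨_)
open import Data.Vec using (Vec; replicate; zipWith)
import Data.Vec as Vec
open import Data.List using (List; foldr)
open import Data.List.Relation.Unary.All using (All)
open import Data.Product using (Σ; ∃; _×_; _,_)
open import Data.Sum using (_⊎_)
open import Relation.Binary.PropositionalEquality using (_≡_; _≢_; refl)
open import Relation.Nullary using (¬_)
open import Function.Definitions using (Injective)

V : ℕ → Set
V n = Vec Bool n

𝟎 : {n : ℕ} → V n
𝟎 = replicate _ false

infixl 6 _⊕_
_⊕_ : {n : ℕ} → V n → V n → V n
_⊕_ = zipWith _xor_

-- A matroid of dimension n: G = nonzero vectors of F₂^n, and a ground set
-- E ⊆ G given by its (Boolean) characteristic function; 0 ∉ E.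
record Matroid (n : ℕ) : Set where
  field
    E     : V n → Bool
    E-nz  : E 𝟎 ≡ false
open Matroid public

FullRank : {n : ℕ} → Matroid n → Set
FullRank {n} M =
  (v : V n) → Σ (List (V n)) λ xs → All (λ x → E M x ≡ true) xs × foldr _⊕_ 𝟎 xs ≡ v

NoFourSumZero : {n : ℕ} → Matroid n → Set
NoFourSumZero {n} M =
  (a b c d : V n) → E M a ≡ true → E M b ≡ true → E M c ≡ true → E M d ≡ true →
  a ≢ b → a ≢ c → a ≢ d → b ≢ c → b ≢ d → c ≢ d →
  a ⊕ b ⊕ c ⊕ d ≢ 𝟎

-- A flat F of G, represented by the subspace F ∪ {0} of F₂^n.
record Flat (n : ℕ) : Set₁ where
  field
    S      : V n → Set
    S-0    : S 𝟎
    S-⊕    : (u w : V n) → S u → S w → S (u ⊕ w)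
open Flat public

-- Over F₂, a linear map is exactly an additive map.
Linear : {k n : ℕ} → (V k → V n) → Set
Linear φ = ∀ u w → φ (u ⊕ w) ≡ φ u ⊕ φ w

RestrIso : {n k : ℕ} → Matroid n → Flat n → Matroid k → Set
RestrIso {n} {k} M F N =
  Σ (V k → V n) λ φ →
    Linear φ × Injective _≡_ _≡_ φ ×
    ((v : V k) → S F (φ v)) ×
    ((w : V n) → S F w → ∃ λ v → φ v ≡ w) ×
    ((v : V k) → E N v ≡ E M (φ v))

Free : {n k : ℕ} → Matroid k → Matroid n → Set₁
Free N M = ¬ (Σ (Flat _) λ F → RestrIso M F N)

-- Vectors of V(G₁) ⊕ V(G₂) = F₂^(n₁+n₂) are written u ++ w with u ∈ F₂^n₁
-- (the copy of V(G₁)) and w ∈ F₂^n₂ (the copy of V(G₂)).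
split : {n₂ : ℕ} (n₁ : ℕ) → V (n₁ + n₂) → V n₁ × V n₂
split ℕ.zero x = Vec.[] , x
split (ℕ.suc n₁) (b Vec.∷ x) with split n₁ x
... | u , w = (b Vec.∷ u) , w

split-𝟎 : {n₂ : ℕ} (n₁ : ℕ) → split {n₂} n₁ 𝟎 ≡ (𝟎 , 𝟎)
split-𝟎 ℕ.zero = refl
split-𝟎 {n₂} (ℕ.suc n₁) rewrite split-𝟎 {n₂} n₁ = refl

isZero : {m : ℕ} → V m → Bool
isZero Vec.[] = true
isZero (false Vec.∷ xs) = isZero xs
isZero (true Vec.∷ xs) = false

-- Lift-join: E(M₁ ⊗ M₂) = E₁ ∪ (E₂ + V(G₁)), i.e. u ++ w is in the ground set
-- iff (u ∈ E₁ and w = 0) or w ∈ E₂.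
joinE : {n₁ n₂ : ℕ} → Matroid n₁ → Matroid n₂ → V (n₁ + n₂) → Bool
joinE {n₁} M₁ M₂ x with split n₁ x
... | u , w = (E M₁ u ∧ isZero w) ∨ E M₂ w

joinE-𝟎 : {n₁ n₂ : ℕ} (M₁ : Matroid n₁) (M₂ : Matroid n₂) → joinE M₁ M₂ 𝟎 ≡ false
joinE-𝟎 {n₁} {n₂} M₁ M₂ rewrite split-𝟎 {n₂} n₁ | E-nz M₁ | E-nz M₂ = refl

infixr 7 _⊗_
_⊗_ : {n₁ n₂ : ℕ} → Matroid n₁ → Matroid n₂ → Matroid (n₁ + n₂)
M₁ ⊗ M₂ = record { E = joinE M₁ M₂ ; E-nz = joinE-𝟎 M₁ M₂ }

-- Let φ embed N as a restriction of M₁ ⊗ M₂ and let ψ be φ followed by the projection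
-- onto V(G₂). Where ψ is nonzero, membership in the ground set of the lift-join is read
-- off through ψ alone, so there E(N) is invariant under translation by ker ψ. If ψ = 0,
-- N is a restriction of M₁; if ker ψ = 0, N is a restriction of M₂. Otherwise take
-- x ≠ 0 in ker ψ, e ∈ E(N) with ψ e ≠ 0 and, as N is full-rank of dimension at least 3,
-- f ∈ E(N) outside span{e, x}. With b = f if ψ f ≠ 0 and b = e + f otherwise, the four
-- distinct elements e, e + x, b, b + x of E(N) sum to zero.

module Submission where

open import Defs
open import Data.Nat using (ℕ; zero; suc; _+_; _≥_; s≤s; z≤n)
open import Data.Bool using (Bool; true; false; _xor_)
open import Data.Bool.Properties
  using (xor-comm; xor-assoc; xor-identityˡ; xor-identityʳ; xor-same; ∧-zeroʳ; ∧-identityʳ; ∨-identityʳ)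
  renaming (_≟_ to _≟ᵇ_)
open import Data.Vec using ([]; _∷_; _++_)
open import Data.Vec.Properties using (≡-dec; zipWith-comm; zipWith-assoc; zipWith-identityˡ; zipWith-identityʳ; zipWith-++)
open import Data.List using (List; []; _∷_; foldr)
open import Data.List.Relation.Unary.All using (All; []; _∷_)
open import Data.Product using (Σ; ∃; _×_; _,_; proj₁; proj₂)
open import Data.Sum using (inj₁; inj₂)
open import Data.Empty using (⊥; ⊥-elim)
open import Function.Definitions using (Injective)
open import Relation.Nullary using (¬_; Dec; yes; no)
open import Relation.Nullary.Decidable using (map′; ¬?; _×-dec_; _⊎-dec_; _→-dec_; from-yes; decidable-stable)
open import Function using (case_of_)
open import Relation.Unary using (Decidable)
open import Relation.Binary.PropositionalEquality
open ≡-Reasoning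

private variable
  k n n₁ n₂ : ℕ

infix 4 _≟_
_≟_ : (u w : V n) → Dec (u ≡ w)
_≟_ = ≡-dec _≟ᵇ_

⊕-comm : (u w : V n) → u ⊕ w ≡ w ⊕ u
⊕-comm = zipWith-comm xor-comm

⊕-assoc : (u w x : V n) → u ⊕ w ⊕ x ≡ u ⊕ (w ⊕ x)
⊕-assoc = zipWith-assoc xor-assoc

⊕-identityˡ : (u : V n) → 𝟎 ⊕ u ≡ u
⊕-identityˡ = zipWith-identityˡ xor-identityˡ

⊕-identityʳ : (u : V n) → u ⊕ 𝟎 ≡ u
⊕-identityʳ = zipWith-identityʳ xor-identityʳ

⊕-same : (u : V n) → u ⊕ u ≡ 𝟎
⊕-same []      = refl
⊕-same (b ∷ u) = cong₂ _∷_ (xor-same b) (⊕-same u)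

⊕-cancelˡ : (u w : V n) → u ⊕ (u ⊕ w) ≡ w
⊕-cancelˡ u w = begin
  u ⊕ (u ⊕ w) ≡⟨ sym (⊕-assoc u u w) ⟩
  u ⊕ u ⊕ w   ≡⟨ cong (_⊕ w) (⊕-same u) ⟩
  𝟎 ⊕ w       ≡⟨ ⊕-identityˡ w ⟩
  w           ∎

⊕-cancelʳ : (u w : V n) → u ⊕ w ⊕ w ≡ u
⊕-cancelʳ u w = begin
  u ⊕ w ⊕ w   ≡⟨ ⊕-assoc u w w ⟩
  u ⊕ (w ⊕ w) ≡⟨ cong (u ⊕_) (⊕-same w) ⟩
  u ⊕ 𝟎       ≡⟨ ⊕-identityʳ u ⟩
  u           ∎

⊕-medial : (u w x y : V n) → (u ⊕ w) ⊕ (x ⊕ y) ≡ (u ⊕ x) ⊕ (w ⊕ y)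
⊕-medial u w x y = begin
  (u ⊕ w) ⊕ (x ⊕ y) ≡⟨ ⊕-assoc u w (x ⊕ y) ⟩
  u ⊕ (w ⊕ (x ⊕ y)) ≡⟨ cong (u ⊕_) (sym (⊕-assoc w x y)) ⟩
  u ⊕ (w ⊕ x ⊕ y)   ≡⟨ cong (λ t → u ⊕ (t ⊕ y)) (⊕-comm w x) ⟩
  u ⊕ (x ⊕ w ⊕ y)   ≡⟨ cong (u ⊕_) (⊕-assoc x w y) ⟩
  u ⊕ (x ⊕ (w ⊕ y)) ≡⟨ sym (⊕-assoc u x (w ⊕ y)) ⟩
  (u ⊕ x) ⊕ (w ⊕ y) ∎

⊕-transpose : {u w x : V n} → u ≡ w ⊕ x → w ≡ u ⊕ x
⊕-transpose {w = w} {x} eq = trans (sym (⊕-cancelʳ w x)) (cong (_⊕ x) (sym eq))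

⊕-injectiveʳ : {u w x : V n} → u ⊕ x ≡ w ⊕ x → u ≡ w
⊕-injectiveʳ {u = u} {x = x} eq = sym (trans (⊕-transpose eq) (⊕-cancelʳ u x))

⊕-injectiveˡ : {u w x : V n} → x ⊕ u ≡ x ⊕ w → u ≡ w
⊕-injectiveˡ {u = u} {w} {x} eq = ⊕-injectiveʳ (trans (⊕-comm u x) (trans eq (⊕-comm x w)))

⊕≡𝟎⇒≡ : {u w : V n} → u ⊕ w ≡ 𝟎 → u ≡ w
⊕≡𝟎⇒≡ {w = w} eq = trans (⊕-transpose (sym eq)) (⊕-identityˡ w)

≡⊕⇒≡𝟎 : {u x : V n} → u ≡ u ⊕ x → x ≡ 𝟎
≡⊕⇒≡𝟎 {u = u} {x} eq = trans (sym (⊕-cancelˡ u x)) (trans (cong (u ⊕_) (sym eq)) (⊕-same u))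

all? : {P : V n → Set} → Decidable P → Dec ((v : V n) → P v)
all? {zero}  P? = map′ (λ p → λ { [] → p }) (λ h → h []) (P? [])
all? {suc n} P? =
  map′ (λ h → λ { (false ∷ v) → proj₁ (h v) ; (true ∷ v) → proj₂ (h v) })
       (λ h v → h (false ∷ v) , h (true ∷ v))
       (all? λ v → P? (false ∷ v) ×-dec P? (true ∷ v))

any? : {P : V n → Set} → Decidable P → Dec (∃ P)
any? {zero}  P? = map′ ([] ,_) (λ { ([] , p) → p }) (P? [])
any? {suc n} P? =
  map′ (λ { (v , inj₁ p) → false ∷ v , p ; (v , inj₂ p) → true ∷ v , p })
       (λ { (false ∷ v , p) → v , inj₁ p ; (true ∷ v , p) → v , inj₂ p })
       (any? λ v → P? (false ∷ v) ⊎-dec P? (true ∷ v))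

Linear-𝟎 : {φ : V k → V n} → Linear φ → φ 𝟎 ≡ 𝟎
Linear-𝟎 {φ = φ} φ-linear = ≡⊕⇒≡𝟎 (begin
  φ 𝟎           ≡⟨ cong φ (sym (⊕-identityˡ 𝟎)) ⟩
  φ (𝟎 ⊕ 𝟎)     ≡⟨ φ-linear 𝟎 𝟎 ⟩
  φ 𝟎 ⊕ φ 𝟎     ∎)

Linear-∘ : {m : ℕ} {φ : V n → V m} {χ : V k → V n} → Linear φ → Linear χ → Linear (λ v → φ (χ v))
Linear-∘ {φ = φ} {χ} φ-linear χ-linear u w = trans (cong φ (χ-linear u w)) (φ-linear (χ u) (χ w))

ker-trivial⇒injective : {φ : V k → V n} → Linear φ → (∀ v → φ v ≡ 𝟎 → v ≡ 𝟎) → Injective _≡_ _≡_ φ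
ker-trivial⇒injective {φ = φ} φ-linear ker-trivial {u} {w} φu≡φw =
  ⊕≡𝟎⇒≡ (ker-trivial (u ⊕ w) (trans (φ-linear u w) (trans (cong (_⊕ φ w) φu≡φw) (⊕-same (φ w)))))

kerFlat : (φ : V k → V n) → Linear φ → Flat k
kerFlat φ φ-linear = record
  { S   = λ v → φ v ≡ 𝟎
  ; S-0 = Linear-𝟎 φ-linear
  ; S-⊕ = λ u w φu≡𝟎 φw≡𝟎 →
      trans (φ-linear u w) (trans (cong₂ _⊕_ φu≡𝟎 φw≡𝟎) (⊕-same 𝟎))
  }

imageFlat : (φ : V k → V n) → Linear φ → Flat n
imageFlat φ φ-linear = record
  { S   = λ w → ∃ λ v → φ v ≡ w
  ; S-0 = 𝟎 , Linear-𝟎 φ-linear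
  ; S-⊕ = λ { u w (a , φa≡u) (b , φb≡w) → a ⊕ b , trans (φ-linear a b) (cong₂ _⊕_ φa≡u φb≡w) }
  }

V2-distinct-nonzero-sum : (p q r : V 2) → p ≢ 𝟎 → q ≢ 𝟎 → r ≢ 𝟎 → p ≢ q → p ≢ r → q ≢ r →
                          p ⊕ q ⊕ r ≡ 𝟎
V2-distinct-nonzero-sum = from-yes
  (all? {2} λ p → all? {2} λ q → all? {2} λ r →
    ¬? (p ≟ 𝟎) →-dec ¬? (q ≟ 𝟎) →-dec ¬? (r ≟ 𝟎) →-dec
    ¬? (p ≟ q) →-dec ¬? (p ≟ r) →-dec ¬? (q ≟ r) →-dec (p ⊕ q ⊕ r ≟ 𝟎))

image-V2-distinct-nonzero-sum :
  {L : V 2 → V n} → Linear L → {p q r : V 2} {u w y : V n} → L p ≡ u → L q ≡ w → L r ≡ y →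
  u ≢ 𝟎 → w ≢ 𝟎 → y ≢ 𝟎 → u ≢ w → u ≢ y → w ≢ y → u ⊕ w ⊕ y ≡ 𝟎
image-V2-distinct-nonzero-sum {L = L} L-linear {p} {q} {r} refl refl refl u≢𝟎 w≢𝟎 y≢𝟎 u≢w u≢y w≢y =
  begin
    L p ⊕ L q ⊕ L r   ≡⟨ cong (_⊕ L r) (sym (L-linear p q)) ⟩
    L (p ⊕ q) ⊕ L r   ≡⟨ sym (L-linear (p ⊕ q) r) ⟩
    L (p ⊕ q ⊕ r)     ≡⟨ cong L (V2-distinct-nonzero-sum p q r
                             (avoids-𝟎 u≢𝟎) (avoids-𝟎 w≢𝟎) (avoids-𝟎 y≢𝟎)
                             (λ p≡q → u≢w (cong L p≡q)) (λ p≡r → u≢y (cong L p≡r))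
                             (λ q≡r → w≢y (cong L q≡r))) ⟩
    L 𝟎               ≡⟨ Linear-𝟎 L-linear ⟩
    𝟎                 ∎
  where
    avoids-𝟎 : {s : V 2} → L s ≢ 𝟎 → s ≢ 𝟎
    avoids-𝟎 Ls≢𝟎 refl = Ls≢𝟎 (Linear-𝟎 L-linear)

unit₁ unit₂ unit₃ : {m : ℕ} → V (3 + m)
unit₁ = true  ∷ false ∷ false ∷ 𝟎
unit₂ = false ∷ true  ∷ false ∷ 𝟎
unit₃ = false ∷ false ∷ true  ∷ 𝟎

image-V2-proper : {m : ℕ} {L : V 2 → V (3 + m)} → Linear L → ∃ λ z → ¬ (∃ λ p → L p ≡ z)
image-V2-proper {m} {L} L-linear
  with any? (λ p → L p ≟ unit₁) | any? (λ p → L p ≟ unit₂) | any? (λ p → L p ≟ unit₃)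
... | no ∉  | _     | _    = _ , ∉
... | yes _ | no ∉  | _    = _ , ∉
... | yes _ | yes _ | no ∉ = _ , ∉
... | yes (_ , Lp₁≡unit₁) | yes (_ , Lp₂≡unit₂) | yes (_ , Lp₃≡unit₃) =
  ⊥-elim (units-sum≢𝟎 (image-V2-distinct-nonzero-sum L-linear Lp₁≡unit₁ Lp₂≡unit₂ Lp₃≡unit₃
                         (λ ()) (λ ()) (λ ()) (λ ()) (λ ()) (λ ())))
  where
    units-sum≢𝟎 : unit₁ ⊕ unit₂ ⊕ unit₃ ≢ 𝟎 {3 + m}
    units-sum≢𝟎 ()

infixr 7 _⊙_
_⊙_ : Bool → V n → V n
true  ⊙ u = u
false ⊙ u = 𝟎

⊙-distribʳ-xor : (a b : Bool) (u : V n) → (a xor b) ⊙ u ≡ a ⊙ u ⊕ b ⊙ u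
⊙-distribʳ-xor false false u = sym (⊕-identityˡ 𝟎)
⊙-distribʳ-xor false true  u = sym (⊕-identityˡ u)
⊙-distribʳ-xor true  false u = sym (⊕-identityʳ u)
⊙-distribʳ-xor true  true  u = sym (⊕-same u)

span₂ : V n → V n → V 2 → V n
span₂ e x (a ∷ c ∷ []) = a ⊙ e ⊕ c ⊙ x

span₂-linear : (e x : V n) → Linear (span₂ e x)
span₂-linear e x (a ∷ c ∷ []) (a′ ∷ c′ ∷ []) = begin
  (a xor a′) ⊙ e ⊕ (c xor c′) ⊙ x       ≡⟨ cong₂ _⊕_ (⊙-distribʳ-xor a a′ e) (⊙-distribʳ-xor c c′ x) ⟩
  (a ⊙ e ⊕ a′ ⊙ e) ⊕ (c ⊙ x ⊕ c′ ⊙ x)   ≡⟨ ⊕-medial (a ⊙ e) (a′ ⊙ e) (c ⊙ x) (c′ ⊙ x) ⟩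
  (a ⊙ e ⊕ c ⊙ x) ⊕ (a′ ⊙ e ⊕ c′ ⊙ x)   ∎

π₁ : (n₁ : ℕ) → V (n₁ + n₂) → V n₁
π₁ n₁ x = proj₁ (split n₁ x)

π₂ : (n₁ : ℕ) → V (n₁ + n₂) → V n₂
π₂ n₁ x = proj₂ (split n₁ x)

split-++ : (u : V n₁) (w : V n₂) → split n₁ (u ++ w) ≡ (u , w)
split-++ []      w = refl
split-++ (b ∷ u) w rewrite split-++ u w = refl

++-split : (n₁ : ℕ) (x : V (n₁ + n₂)) → π₁ n₁ x ++ π₂ n₁ x ≡ x
++-split zero     x       = refl
++-split (suc n₁) (b ∷ x) with split n₁ x | ++-split n₁ x
... | u , w | u++w≡x = cong (b ∷_) u++w≡x

split-⊕ : (n₁ : ℕ) (x y : V (n₁ + n₂)) →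
          split n₁ (x ⊕ y) ≡ (π₁ n₁ x ⊕ π₁ n₁ y , π₂ n₁ x ⊕ π₂ n₁ y)
split-⊕ n₁ x y = begin
  split n₁ (x ⊕ y)
    ≡⟨ cong (split n₁) (cong₂ _⊕_ (sym (++-split n₁ x)) (sym (++-split n₁ y))) ⟩
  split n₁ ((π₁ n₁ x ++ π₂ n₁ x) ⊕ (π₁ n₁ y ++ π₂ n₁ y))
    ≡⟨ cong (split n₁) (zipWith-++ _xor_ (π₁ n₁ x) (π₂ n₁ x) (π₁ n₁ y) (π₂ n₁ y)) ⟩
  split n₁ ((π₁ n₁ x ⊕ π₁ n₁ y) ++ (π₂ n₁ x ⊕ π₂ n₁ y))
    ≡⟨ split-++ (π₁ n₁ x ⊕ π₁ n₁ y) (π₂ n₁ x ⊕ π₂ n₁ y) ⟩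
  (π₁ n₁ x ⊕ π₁ n₁ y , π₂ n₁ x ⊕ π₂ n₁ y) ∎

π₁-linear : (n₁ : ℕ) → Linear (π₁ {n₂} n₁)
π₁-linear n₁ x y = cong proj₁ (split-⊕ n₁ x y)

π₂-linear : (n₁ : ℕ) → Linear (π₂ {n₂} n₁)
π₂-linear n₁ x y = cong proj₂ (split-⊕ n₁ x y)

isZero-𝟎 : (n : ℕ) → isZero {n} 𝟎 ≡ true
isZero-𝟎 zero    = refl
isZero-𝟎 (suc n) = isZero-𝟎 n

isZero-≢𝟎 : {w : V n} → w ≢ 𝟎 → isZero w ≡ false
isZero-≢𝟎 {w = []}        w≢𝟎 = ⊥-elim (w≢𝟎 refl)
isZero-≢𝟎 {w = true  ∷ w} w≢𝟎 = refl
isZero-≢𝟎 {w = false ∷ w} w≢𝟎 = isZero-≢𝟎 (λ w≡𝟎 → w≢𝟎 (cong (false ∷_) w≡𝟎))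

joinE-π₂≢𝟎 : (M₁ : Matroid n₁) (M₂ : Matroid n₂) (x : V (n₁ + n₂)) →
             π₂ n₁ x ≢ 𝟎 → E (M₁ ⊗ M₂) x ≡ E M₂ (π₂ n₁ x)
joinE-π₂≢𝟎 {n₁} M₁ M₂ x w≢𝟎 with split n₁ x
... | u , w rewrite isZero-≢𝟎 w≢𝟎 | ∧-zeroʳ (E M₁ u) = refl

joinE-π₂≡𝟎 : (M₁ : Matroid n₁) (M₂ : Matroid n₂) (x : V (n₁ + n₂)) →
             π₂ n₁ x ≡ 𝟎 → E (M₁ ⊗ M₂) x ≡ E M₁ (π₁ n₁ x)
joinE-π₂≡𝟎 {n₁} {n₂} M₁ M₂ x w≡𝟎 with split n₁ x
... | u , w rewrite w≡𝟎 | isZero-𝟎 n₂ | E-nz M₂ | ∧-identityʳ (E M₁ u) = ∨-identityʳ (E M₁ u)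

summand∉flat : {P : V n → Set} (F : Flat n) → Decidable (S F) → (xs : List (V n)) → All P xs →
               ¬ S F (foldr _⊕_ 𝟎 xs) → ∃ λ y → P y × ¬ S F y
summand∉flat F S? []       []         sum∉ = ⊥-elim (sum∉ (S-0 F))
summand∉flat F S? (y ∷ ys) (Py ∷ Pys) sum∉ with S? y
... | no  y∉ = y , Py , y∉
... | yes y∈ = summand∉flat F S? ys Pys (λ ys∈ → sum∉ (S-⊕ F y _ y∈ ys∈))

FullRank⇒E⊈flat : (N : Matroid k) → FullRank N → (F : Flat k) → Decidable (S F) →
                  {v : V k} → ¬ S F v → ∃ λ y → E N y ≡ true × ¬ S F y
FullRank⇒E⊈flat N full F S? {v} v∉ with full v
... | xs , xs⊆E , sum≡v = summand∉flat F S? xs xs⊆E (λ sum∈ → v∉ (subst (S F) sum≡v sum∈))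

E≡true⇒≢𝟎 : (N : Matroid k) {y : V k} → E N y ≡ true → y ≢ 𝟎
E≡true⇒≢𝟎 N Ey refl with trans (sym Ey) (E-nz N)
... | ()

linear-embedding⇒restriction : (M : Matroid n) (N : Matroid k) {φ : V k → V n} → Linear φ →
                               Injective _≡_ _≡_ φ → (∀ v → E N v ≡ E M (φ v)) →
                               Σ (Flat n) λ F → RestrIso M F N
linear-embedding⇒restriction M N {φ} φ-linear φ-injective E-φ =
  imageFlat φ φ-linear , φ , φ-linear , φ-injective , (λ v → v , refl) , (λ w w∈ → w∈) , E-φ

NoFourSumZero⇒no-translated-pairs :
  (N : Matroid k) → NoFourSumZero N → {a b x : V k} → x ≢ 𝟎 → b ≢ a → b ≢ a ⊕ x →
  E N a ≡ true → E N (a ⊕ x) ≡ true → E N b ≡ true → E N (b ⊕ x) ≡ true → ⊥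
NoFourSumZero⇒no-translated-pairs N nf {a} {b} {x} x≢𝟎 b≢a b≢a⊕x Ea Ea⊕x Eb Eb⊕x =
  nf a (a ⊕ x) b (b ⊕ x) Ea Ea⊕x Eb Eb⊕x
     (λ eq → x≢𝟎 (≡⊕⇒≡𝟎 eq)) (λ eq → b≢a (sym eq)) (λ eq → b≢a⊕x (⊕-transpose eq))
     (λ eq → b≢a⊕x (sym eq)) (λ eq → b≢a (sym (⊕-injectiveʳ eq))) (λ eq → x≢𝟎 (≡⊕⇒≡𝟎 eq))
     sum≡𝟎
  where
    sum≡𝟎 : a ⊕ (a ⊕ x) ⊕ b ⊕ (b ⊕ x) ≡ 𝟎
    sum≡𝟎 = begin
      a ⊕ (a ⊕ x) ⊕ b ⊕ (b ⊕ x) ≡⟨ cong (λ t → t ⊕ b ⊕ (b ⊕ x)) (⊕-cancelˡ a x) ⟩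
      x ⊕ b ⊕ (b ⊕ x)           ≡⟨ cong (x ⊕ b ⊕_) (⊕-comm b x) ⟩
      x ⊕ b ⊕ (x ⊕ b)           ≡⟨ ⊕-same (x ⊕ b) ⟩
      𝟎                         ∎

ker-translate : {ψ : V k → V n} → Linear ψ → (y : V k) {z : V k} → ψ z ≡ 𝟎 → ψ (y ⊕ z) ≡ ψ y
ker-translate {ψ = ψ} ψ-linear y {z} ψz≡𝟎 =
  trans (ψ-linear y z) (trans (cong (ψ y ⊕_) ψz≡𝟎) (⊕-identityʳ (ψ y)))

factorisation-ker-invariant :
  (N : Matroid k) {ψ : V k → V n} → Linear ψ → (g : V n → Bool) → (∀ y → ψ y ≢ 𝟎 → E N y ≡ g (ψ y)) →
  {y z : V k} → ψ y ≢ 𝟎 → ψ z ≡ 𝟎 → E N (y ⊕ z) ≡ E N y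
factorisation-ker-invariant N {ψ} ψ-linear g E-factors {y} {z} ψy≢𝟎 ψz≡𝟎 = begin
  E N (y ⊕ z)   ≡⟨ E-factors (y ⊕ z) (λ ψy⊕z≡𝟎 → ψy≢𝟎 (trans (sym ψy⊕z≡ψy) ψy⊕z≡𝟎)) ⟩
  g (ψ (y ⊕ z)) ≡⟨ cong g ψy⊕z≡ψy ⟩
  g (ψ y)       ≡⟨ sym (E-factors y ψy≢𝟎) ⟩
  E N y         ∎
  where
    ψy⊕z≡ψy : ψ (y ⊕ z) ≡ ψ y
    ψy⊕z≡ψy = ker-translate ψ-linear y ψz≡𝟎

module _ {m : ℕ} (N : Matroid (3 + m)) (full : FullRank N) (nf : NoFourSumZero N)
         {ψ : V (3 + m) → V n} (ψ-linear : Linear ψ) (g : V n → Bool)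
         (E-factors : ∀ y → ψ y ≢ 𝟎 → E N y ≡ g (ψ y)) where

  private
    E-shift : {y z : V (3 + m)} → ψ y ≢ 𝟎 → ψ z ≡ 𝟎 → E N y ≡ true → E N (y ⊕ z) ≡ true
    E-shift ψy≢𝟎 ψz≡𝟎 Ey = trans (factorisation-ker-invariant N ψ-linear g E-factors ψy≢𝟎 ψz≡𝟎) Ey

  factorisation⇒ker-trivial : {v : V (3 + m)} → ψ v ≢ 𝟎 → (x : V (3 + m)) → ψ x ≡ 𝟎 → x ≡ 𝟎
  factorisation⇒ker-trivial ψv≢𝟎 x ψx≡𝟎 with x ≟ 𝟎
  ... | yes x≡𝟎 = x≡𝟎
  ... | no  x≢𝟎
    with e , Ee , ψe≢𝟎 ← FullRank⇒E⊈flat N full (kerFlat ψ ψ-linear) (λ y → ψ y ≟ 𝟎) ψv≢𝟎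
    with f , Ef , f∉⟨e,x⟩ ← FullRank⇒E⊈flat N full (imageFlat (span₂ e x) (span₂-linear e x))
                              (λ z → any? λ p → span₂ e x p ≟ z) (proj₂ (image-V2-proper (span₂-linear e x)))
    with ψ f ≟ 𝟎
  ... | no ψf≢𝟎 =
    ⊥-elim (NoFourSumZero⇒no-translated-pairs N nf x≢𝟎
              (λ f≡e → f∉⟨e,x⟩ (true ∷ false ∷ [] , trans (⊕-identityʳ e) (sym f≡e)))
              (λ f≡e⊕x → f∉⟨e,x⟩ (true ∷ true ∷ [] , sym f≡e⊕x))
              Ee (E-shift ψe≢𝟎 ψx≡𝟎 Ee) Ef (E-shift ψf≢𝟎 ψx≡𝟎 Ef))
  ... | yes ψf≡𝟎 =
    ⊥-elim (NoFourSumZero⇒no-translated-pairs N nf x≢𝟎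
              (λ e⊕f≡e → E≡true⇒≢𝟎 N Ef (≡⊕⇒≡𝟎 (sym e⊕f≡e)))
              (λ e⊕f≡e⊕x → f∉⟨e,x⟩ (false ∷ true ∷ [] , trans (⊕-identityˡ x) (sym (⊕-injectiveˡ e⊕f≡e⊕x))))
              Ee (E-shift ψe≢𝟎 ψx≡𝟎 Ee) Ee⊕f (E-shift ψe⊕f≢𝟎 ψx≡𝟎 Ee⊕f))
    where
      Ee⊕f : E N (e ⊕ f) ≡ true
      Ee⊕f = E-shift ψe≢𝟎 ψf≡𝟎 Ee
      ψe⊕f≢𝟎 : ψ (e ⊕ f) ≢ 𝟎
      ψe⊕f≢𝟎 ψe⊕f≡𝟎 = ψe≢𝟎 (trans (sym (ker-translate ψ-linear e ψf≡𝟎)) ψe⊕f≡𝟎)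

module JoinRestriction {k n₁ n₂ : ℕ} (N : Matroid k) (M₁ : Matroid n₁) (M₂ : Matroid n₂)
                       {φ : V k → V (n₁ + n₂)} (φ-linear : Linear φ) (φ-injective : Injective _≡_ _≡_ φ)
                       (E-φ : ∀ v → E N v ≡ E (M₁ ⊗ M₂) (φ v)) where

  ψ : V k → V n₂
  ψ v = π₂ n₁ (φ v)

  ψ-linear : Linear ψ
  ψ-linear = Linear-∘ (π₂-linear n₁) φ-linear

  E-factors : ∀ v → ψ v ≢ 𝟎 → E N v ≡ E M₂ (ψ v)
  E-factors v ψv≢𝟎 = trans (E-φ v) (joinE-π₂≢𝟎 M₁ M₂ (φ v) ψv≢𝟎)

  restriction₂ : (∀ v → ψ v ≡ 𝟎 → v ≡ 𝟎) → Σ (Flat n₂) λ F → RestrIso M₂ F N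
  restriction₂ ker-trivial =
    linear-embedding⇒restriction M₂ N ψ-linear (ker-trivial⇒injective ψ-linear ker-trivial) E-ψ
    where
      E-ψ : ∀ v → E N v ≡ E M₂ (ψ v)
      E-ψ v with ψ v ≟ 𝟎
      ... | no  ψv≢𝟎 = E-factors v ψv≢𝟎
      ... | yes ψv≡𝟎 = begin
        E N v      ≡⟨ cong (E N) (ker-trivial v ψv≡𝟎) ⟩
        E N 𝟎      ≡⟨ E-nz N ⟩
        false      ≡⟨ sym (E-nz M₂) ⟩
        E M₂ 𝟎     ≡⟨ cong (E M₂) (sym ψv≡𝟎) ⟩
        E M₂ (ψ v) ∎

  restriction₁ : (∀ v → ψ v ≡ 𝟎) → Σ (Flat n₁) λ F → RestrIso M₁ F N
  restriction₁ ψ≡𝟎 =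
    linear-embedding⇒restriction M₁ N (Linear-∘ (π₁-linear n₁) φ-linear) φ₁-injective
      (λ v → trans (E-φ v) (joinE-π₂≡𝟎 M₁ M₂ (φ v) (ψ≡𝟎 v)))
    where
      φ₁-injective : Injective _≡_ _≡_ (λ v → π₁ n₁ (φ v))
      φ₁-injective {a} {b} φ₁a≡φ₁b = φ-injective (begin
        φ a                ≡⟨ sym (++-split n₁ (φ a)) ⟩
        π₁ n₁ (φ a) ++ ψ a ≡⟨ cong₂ _++_ φ₁a≡φ₁b (trans (ψ≡𝟎 a) (sym (ψ≡𝟎 b))) ⟩
        π₁ n₁ (φ b) ++ ψ b ≡⟨ ++-split n₁ (φ b) ⟩
        φ b                ∎)

lemma2p4 : {k : ℕ} (N : Matroid k) → FullRank N → k ≥ 3 → NoFourSumZero N →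
           {n₁ n₂ : ℕ} (M₁ : Matroid n₁) (M₂ : Matroid n₂) →
           Free N M₁ → Free N M₂ → Free N (M₁ ⊗ M₂)
lemma2p4 N full (s≤s (s≤s (s≤s z≤n))) nf M₁ M₂ free₁ free₂ (_ , φ , φ-linear , φ-injective , _ , _ , E-φ) =
  case any? (λ v → ¬? (ψ v ≟ 𝟎)) of λ where
    (yes (_ , ψv≢𝟎)) →
      free₂ (restriction₂ (factorisation⇒ker-trivial N full nf ψ-linear (E M₂) E-factors ψv≢𝟎))
    (no ψ-nowhere-nonzero) →
      free₁ (restriction₁ λ v → decidable-stable (ψ v ≟ 𝟎) λ ψv≢𝟎 → ψ-nowhere-nonzero (v , ψv≢𝟎))
  where open JoinRestriction N M₁ M₂ φ-linear φ-injective E-φ
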